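{- Let $G$ be a finite vertex-transitive bipartite graph. Then $G$ is IS-imprimitive if and only if $G$ is disconnected.
   Context: Graphs are finite, simple and undirected; $\alpha(G)$ is the independence number. For $A\subseteq V(G)$, $N_G[A]$ is $A$ together with all vertices adjacent to some vertex of $A$. A nonempty independent set $A$ of $G$ is imprimitive if $|A|<\alpha(G)$ and $\frac{|A|}{|N_G[A]|}=\frac{\alpha(G)}{|V(G)|}$; $G$ is IS-imprimitive if it has an imprimitive independent set. -}

module Defs where

open import Data.Nat using (ℕ; zero; suc; _*_; _<_; _⊔_)
open import Data.Bool using (Bool; true; false; not; _∧_; _∨_; if_then_else_)
open import Data.Fin using (Fin)
open import Data.Fin.Subset using (Subset; _∈_; Nonempty; ∣_∣; inside; outside)
open import Data.Fin.Permutation using (Permutation′; _⟨$⟩ʳ_)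
open import Data.List using (List; []; _∷_; _++_; map; foldr; allFin; concatMap)
open import Data.Bool.ListAction using (and; any)
open import Data.Vec using (Vec; []; _∷_; lookup; tabulate)
open import Data.Product using (Σ; _×_; ∃)
open import Relation.Binary.PropositionalEquality using (_≡_; _≢_)
open import Relation.Binary.Construct.Closure.ReflexiveTransitive using (Star)
open import Relation.Nullary using (¬_)

record Graph : Set where
  field
    n      : ℕ
    adj    : Fin n → Fin n → Bool
    adj-sym    : ∀ u v → adj u v ≡ adj v u
    adj-irrefl : ∀ v → adj v v ≡ false
open Graph public

order : Graph → ℕ
order G = n G

Independent : (G : Graph) → Subset (n G) → Set
Independent G A = ∀ u v → u ∈ A → v ∈ A → adj G u v ≡ false

independentᵇ : (G : Graph) → Subset (n G) → Bool
independentᵇ G A =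
  and (concatMap (λ u → map (λ v → not (lookup A u ∧ lookup A v ∧ adj G u v))
                              (allFin (n G)))
                 (allFin (n G)))

allSubsets : (m : ℕ) → List (Subset m)
allSubsets zero    = [] ∷ []
allSubsets (suc m) = map (inside ∷_) (allSubsets m) ++ map (outside ∷_) (allSubsets m)

α : Graph → ℕ
α G = foldr (λ A r → if independentᵇ G A then ∣ A ∣ ⊔ r else r) 0 (allSubsets (n G))

N[_]_ : (G : Graph) → Subset (n G) → Subset (n G)
N[ G ] A = tabulate λ v → lookup A v ∨ any (λ u → lookup A u ∧ adj G u v) (allFin (n G))

-- Imprimitive independent set: nonempty, independent, |A| < α(G),
-- and |A| / |N[A]| = α(G) / |V(G)| (cross-multiplied; both denominators
-- are positive since A is nonempty).
Imprimitive : (G : Graph) → Subset (n G) → Set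
Imprimitive G A =
  Independent G A × Nonempty A × ∣ A ∣ < α G ×
  ∣ A ∣ * order G ≡ α G * ∣ N[ G ] A ∣

IS-imprimitive : Graph → Set
IS-imprimitive G = ∃ λ A → Imprimitive G A

IsAutomorphism : (G : Graph) → Permutation′ (n G) → Set
IsAutomorphism G π = ∀ u v → adj G (π ⟨$⟩ʳ u) (π ⟨$⟩ʳ v) ≡ adj G u v

VertexTransitive : Graph → Set
VertexTransitive G =
  ∀ u v → Σ (Permutation′ (n G)) λ π → IsAutomorphism G π × π ⟨$⟩ʳ u ≡ v

Bipartite : Graph → Set
Bipartite G = Σ (Fin (n G) → Bool) λ c → ∀ u v → adj G u v ≡ true → c u ≢ c v

Adj : (G : Graph) → Fin (n G) → Fin (n G) → Set
Adj G u v = adj G u v ≡ true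

Connected : Graph → Set
Connected G = ∀ u v → Star (Adj G) u v

Disconnected : Graph → Set
Disconnected G = ¬ Connected G

module Submission where

-- Vertex-transitivity makes G d-regular, and double
-- counting the edges between P and N(P) gives the expansion inequality
-- |P|·d ≤ |N(P)|·d; when it is an equality, P ∪ N(P) is closed under
-- adjacency.  For a proper 2-colouring c, each colour class is independent,
-- so |V| ≤ 2α; an independent set B splits into B₁ = B ∩ c and B₂ = B ∩ ¬c,
-- and B₁, B₂, N(B₁), N(B₂) are disjoint inside N[B].
--
-- (⇒) If A is imprimitive, |A|·|V| = α·|N[A]|, |V| ≤ 2α and |A| < α force
-- |N[A]| ≤ 2|A|, so the expansion of B₁ = A ∩ c is tight and B₁ ∪ N(B₁)
-- is closed.  Colouring a vertex s ∈ A into B₁, connectivity makes this set,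
-- hence N[A], all of V, and then |A| = α: a contradiction.
-- (⇐) If G is disconnected, a vertex u has a closed set T (its component,
-- found as an iterated neighbourhood) missing some vertex.  Colouring u
-- true, A = T ∩ c is imprimitive: if G is edgeless then α = |V| and
-- N[A] = A; otherwise |V| = 2α, and with Ā = T ∩ ¬c the chain
-- |A| ≤ |N(A)| ≤ |Ā| ≤ |N(Ā)| ≤ |A| gives |N[A]| = 2|A| ≤ |T| < |V|.

open import Defs
open import Data.Nat using (ℕ; zero; suc; _+_; _*_; _≤_; _<_; z≤n; _⊔_; >-nonZero)
open import Data.Nat.Properties hiding (_≟_)
open import Data.Nat.Tactic.RingSolver using (solve-∀)
open import Data.Bool using (Bool; true; false; not; _∧_; _∨_; if_then_else_; T)
import Data.Bool as Bool
open import Data.Bool.Properties using (∨-zeroʳ; ∨-identityʳ; ∧-conicalˡ; ∧-conicalʳ; ¬-not; not-injective; T-≡)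
open import Data.Bool.ListAction using (and; or; any)
open import Data.Fin using (Fin; zero; suc; _≟_)
open import Data.Fin.Properties using (all?; ¬∀⟶∃¬; nonZeroIndex)
open import Data.Fin.Subset using (Subset; _∈_; ∣_∣)
open import Data.Fin.Permutation using (_⟨$⟩ʳ_)
open import Data.List using ([]; _∷_; map; foldr; allFin)
open import Data.List.Properties using (map-cong)
open import Data.List.Membership.Propositional using (lose) renaming (_∈_ to _∈ₗ_)
open import Data.List.Membership.Propositional.Properties using (∈-allFin; ∈-++⁺ˡ; ∈-++⁺ʳ; ∈-map⁺)
open import Data.List.Relation.Unary.All as All using (All; []; _∷_)
open import Data.List.Relation.Unary.All.Properties using (concat⁺; concat⁻; map⁺; map⁻; tabulate⁺)
open import Data.List.Relation.Unary.Any using (here; there; satisfied)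
open import Data.List.Relation.Unary.Any.Properties using (any⁺; any⁻)
open import Data.Vec using ([]; _∷_; lookup; tabulate)
open import Data.Vec.Properties using (lookup∘tabulate; lookup⇒[]=; []=⇒lookup)
open import Data.Product using (∃; ∃₂; _×_; _,_; proj₁; proj₂)
open import Data.Sum using (_⊎_; inj₁; inj₂)
open import Data.Empty using (⊥; ⊥-elim)
open import Function using (_∘_; id; Equivalence)
open import Relation.Binary.PropositionalEquality
open import Relation.Binary.Construct.Closure.ReflexiveTransitive using (Star; ε; _◅_; _◅◅_)
open import Relation.Nullary using (¬_; Dec; yes; no; does)
open import Relation.Nullary.Decidable using (_→-dec_; dec-true)
open import Algebra.Properties.Semiring.Sum +-*-semiring using (sum; sum-cong-≗; ∑-distrib-+; ∑-comm; sum-permute; *-distribʳ-sum; sum-replicate-zero)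

double-swap : ∀ x y → x * (y + y) ≡ y * (x + x)
double-swap = solve-∀

ratio-bound : ∀ {a n α N} → a * n ≡ α * N → n ≤ α + α → a < α → N ≤ a + a
ratio-bound {a} {n} {α} {N} balanced n≤2α a<α =
  *-cancelˡ-≤ α {{>-nonZero (≤-<-trans z≤n a<α)}} (begin
    α * N        ≡⟨ sym balanced ⟩
    a * n        ≤⟨ *-monoʳ-≤ a n≤2α ⟩
    a * (α + α)  ≡⟨ double-swap a α ⟩
    α * (a + a)  ∎)
  where open ≤-Reasoning

cancel-pair : ∀ {x₁ x₂ y₁ y₂} → x₂ ≤ y₂ → y₁ + y₂ ≤ x₁ + x₂ → y₁ ≤ x₁
cancel-pair {x₁} {x₂} {y₁} x₂≤y₂ sum≤ =
  +-cancelʳ-≤ x₂ y₁ x₁ (≤-trans (+-monoʳ-≤ y₁ x₂≤y₂) sum≤)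

half-< : ∀ {x y} → x + x < y + y → x < y
half-< x+x<y+y = ≰⇒> (λ y≤x → <⇒≱ x+x<y+y (+-mono-≤ y≤x y≤x))

∧-elim : ∀ {a b} → a ∧ b ≡ true → a ≡ true × b ≡ true
∧-elim {a} {b} h = ∧-conicalˡ a b h , ∧-conicalʳ a b h

not-true : ∀ {b} → not b ≡ true → b ≡ false
not-true {false} _ = refl

T⇒≡ : ∀ {b} → T b → b ≡ true
T⇒≡ = Equivalence.to T-≡

≡⇒T : ∀ {b} → b ≡ true → T b
≡⇒T = Equivalence.from T-≡

and-true⁻ : ∀ bs → and bs ≡ true → All (_≡ true) bs
and-true⁻ []          _ = []
and-true⁻ (true ∷ bs) h = refl ∷ and-true⁻ bs h

and-true⁺ : ∀ {bs} → All (_≡ true) bs → and bs ≡ true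
and-true⁺ []         = refl
and-true⁺ (refl ∷ h) = and-true⁺ h

𝟙 : Bool → ℕ
𝟙 true  = 1
𝟙 false = 0

𝟙-mono : ∀ {a b} → (a ≡ true → b ≡ true) → 𝟙 a ≤ 𝟙 b
𝟙-mono {true}  a⇒b rewrite a⇒b refl = ≤-refl
𝟙-mono {false} _   = z≤n

𝟙≤0 : ∀ {b} → 𝟙 b ≤ 0 → b ≡ false
𝟙≤0 {false} _ = refl

module _ {A : Set} where

  infixr 7 _∩_
  infixr 6 _∪_
  infix 4 _⊆_

  _∩_ _∪_ : (A → Bool) → (A → Bool) → A → Bool
  (P ∩ Q) x = P x ∧ Q x
  (P ∪ Q) x = P x ∨ Q x

  ∁ : (A → Bool) → A → Bool
  ∁ P x = not (P x)

  _⊆_ : (A → Bool) → (A → Bool) → Set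
  P ⊆ Q = ∀ x → P x ≡ true → Q x ≡ true

  Disjoint : (A → Bool) → (A → Bool) → Set
  Disjoint P Q = ∀ x → P x ≡ true → Q x ≡ true → ⊥

  ⊆-trans : ∀ {P Q R} → P ⊆ Q → Q ⊆ R → P ⊆ R
  ⊆-trans P⊆Q Q⊆R x = Q⊆R x ∘ P⊆Q x

  ∩-⊆ˡ : ∀ {P Q} → P ∩ Q ⊆ P
  ∩-⊆ˡ x = proj₁ ∘ ∧-elim

  ∩-⊆ʳ : ∀ {P Q} → P ∩ Q ⊆ Q
  ∩-⊆ʳ x = proj₂ ∘ ∧-elim

  ⊆-∩ : ∀ {P Q R} → P ⊆ Q → P ⊆ R → P ⊆ Q ∩ R
  ⊆-∩ P⊆Q P⊆R x Px = cong₂ _∧_ (P⊆Q x Px) (P⊆R x Px)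

  ∪-⊆ˡ : ∀ {P Q} → P ⊆ P ∪ Q
  ∪-⊆ˡ x Px = cong (_∨ _) Px

  ∪-⊆ʳ : ∀ {P Q} → Q ⊆ P ∪ Q
  ∪-⊆ʳ {P} x Qx = trans (cong (P x ∨_) Qx) (∨-zeroʳ (P x))

  ∪-mono : ∀ {P P′ Q Q′} → P ⊆ P′ → Q ⊆ Q′ → P ∪ Q ⊆ P′ ∪ Q′
  ∪-mono {P} {P′} {Q} {Q′} P⊆P′ Q⊆Q′ x h with P x in Px
  ... | true  = ∪-⊆ˡ {P′} {Q′} x (P⊆P′ x Px)
  ... | false = ∪-⊆ʳ {P′} {Q′} x (Q⊆Q′ x h)

  Disjoint-mono : ∀ {P P′ Q Q′} → P′ ⊆ P → Q′ ⊆ Q → Disjoint P Q → Disjoint P′ Q′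
  Disjoint-mono P′⊆P Q′⊆Q disj x P′x Q′x = disj x (P′⊆P x P′x) (Q′⊆Q x Q′x)

  ∩-∁-disjoint : ∀ {P Q c} → Disjoint (P ∩ c) (Q ∩ ∁ c)
  ∩-∁-disjoint {P} {Q} {c} x Pcx Qc̄x with () ←
    trans (sym (∩-⊆ʳ {P} {c} x Pcx)) (not-true (∩-⊆ʳ {Q} {∁ c} x Qc̄x))

sum-mono : ∀ {m} {f g : Fin m → ℕ} → (∀ i → f i ≤ g i) → sum f ≤ sum g
sum-mono {zero}  f≤g = z≤n
sum-mono {suc m} f≤g = +-mono-≤ (f≤g zero) (sum-mono (f≤g ∘ suc))

sum-mono-< : ∀ {m} {f g : Fin m → ℕ} → (∀ i → f i ≤ g i) → ∀ j → f j < g j → sum f < sum g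
sum-mono-< f≤g zero    fj<gj = +-mono-<-≤ fj<gj (sum-mono (f≤g ∘ suc))
sum-mono-< f≤g (suc j) fj<gj = +-mono-≤-< (f≤g zero) (sum-mono-< (f≤g ∘ suc) j fj<gj)

term≤sum : ∀ {m} (f : Fin m → ℕ) j → f j ≤ sum f
term≤sum f zero    = m≤m+n _ _
term≤sum f (suc j) = ≤-trans (term≤sum (f ∘ suc) j) (m≤n+m _ _)

count : ∀ {m} → (Fin m → Bool) → ℕ
count P = sum (𝟙 ∘ P)

module _ {m : ℕ} where

  count-cong : ∀ {P Q : Fin m → Bool} → (∀ x → P x ≡ Q x) → count P ≡ count Q
  count-cong P≗Q = sum-cong-≗ (cong 𝟙 ∘ P≗Q)

  count-all : count {m} (λ _ → true) ≡ m
  count-all = go m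
    where
    go : ∀ k → count {k} (λ _ → true) ≡ k
    go zero    = refl
    go (suc k) = cong suc (go k)

  count-full : ∀ {P : Fin m → Bool} → (∀ x → P x ≡ true) → count P ≡ m
  count-full full = trans (count-cong full) count-all

  count-mono : ∀ {P Q : Fin m → Bool} → P ⊆ Q → count P ≤ count Q
  count-mono P⊆Q = sum-mono (λ x → 𝟙-mono (P⊆Q x))

  count-mono-< : ∀ {P Q : Fin m → Bool} {x} → P ⊆ Q → Q x ≡ true → P x ≡ false → count P < count Q
  count-mono-< {x = x} P⊆Q Qx Px =
    sum-mono-< (λ y → 𝟙-mono (P⊆Q y)) x (subst₂ (λ p q → 𝟙 p < 𝟙 q) (sym Px) (sym Qx) ≤-refl)

  count≤ : ∀ (P : Fin m → Bool) → count P ≤ m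
  count≤ P = ≤-trans (count-mono {Q = λ _ → true} (λ _ _ → refl)) (≤-reflexive count-all)

  count-< : ∀ {P : Fin m → Bool} {x} → P x ≡ false → count P < m
  count-< Px = <-≤-trans (count-mono-< {Q = λ _ → true} (λ _ _ → refl) refl Px) (≤-reflexive count-all)

  count-split : ∀ (P c : Fin m → Bool) → count P ≡ count (P ∩ c) + count (P ∩ ∁ c)
  count-split P c = trans (sum-cong-≗ (λ x → split (P x) (c x))) (∑-distrib-+ (𝟙 ∘ (P ∩ c)) (𝟙 ∘ (P ∩ ∁ c)))
    where
    split : ∀ p b → 𝟙 p ≡ 𝟙 (p ∧ b) + 𝟙 (p ∧ not b)
    split true  true  = refl
    split true  false = refl
    split false _     = refl

  count-disjoint-≤ : ∀ {P Q R : Fin m → Bool} → Disjoint P Q → P ⊆ R → Q ⊆ R → count P + count Q ≤ count R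
  count-disjoint-≤ {P} {Q} {R} disj P⊆R Q⊆R =
    ≤-trans (≤-reflexive (sym (∑-distrib-+ (𝟙 ∘ P) (𝟙 ∘ Q))))
            (sum-mono (λ x → pointwise (P x) (Q x) (disj x) (P⊆R x) (Q⊆R x)))
    where
    pointwise : ∀ p q {r} → (p ≡ true → q ≡ true → ⊥) → (p ≡ true → r ≡ true) → (q ≡ true → r ≡ true) →
                𝟙 p + 𝟙 q ≤ 𝟙 r
    pointwise true  true  disj _   _   = ⊥-elim (disj refl refl)
    pointwise true  false _    p⇒r _   = 𝟙-mono p⇒r
    pointwise false q     _    _   q⇒r = 𝟙-mono q⇒r

  count-disjoint-∪ : ∀ {P Q : Fin m → Bool} → Disjoint P Q → count (P ∪ Q) ≡ count P + count Q
  count-disjoint-∪ {P} {Q} disj = trans (sum-cong-≗ (λ x → pointwise (P x) (Q x) (disj x))) (∑-distrib-+ (𝟙 ∘ P) (𝟙 ∘ Q))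
    where
    pointwise : ∀ p q → (p ≡ true → q ≡ true → ⊥) → 𝟙 (p ∨ q) ≡ 𝟙 p + 𝟙 q
    pointwise true  true  disj = ⊥-elim (disj refl refl)
    pointwise true  false _    = refl
    pointwise false q     _    = refl

  count-guarded : ∀ b (p : Fin m → Bool) → count (λ i → b ∧ p i) ≡ 𝟙 b * count p
  count-guarded true  p = sym (+-identityʳ (count p))
  count-guarded false p = sum-replicate-zero m

⊆-at? : ∀ {m} (P Q : Fin m → Bool) x → Dec (P x ≡ true → Q x ≡ true)
⊆-at? P Q x = (P x Bool.≟ true) →-dec (Q x Bool.≟ true)

⊆-or-escape : ∀ {m} (P Q : Fin m → Bool) → P ⊆ Q ⊎ ∃ λ x → P x ≡ true × Q x ≡ false
⊆-or-escape {m} P Q with all? (⊆-at? P Q)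
... | yes P⊆Q = inj₁ P⊆Q
... | no  P⊈Q with ¬∀⟶∃¬ m _ (⊆-at? P Q) P⊈Q
...   | x , escapes = inj₂ (x , escape escapes)
  where
  escape : ∀ {p q} → ¬ (p ≡ true → q ≡ true) → p ≡ true × q ≡ false
  escape {true}  {false} _    = refl , refl
  escape {true}  {true}  ¬p⇒q = ⊥-elim (¬p⇒q (λ _ → refl))
  escape {false}         ¬p⇒q = ⊥-elim (¬p⇒q (λ ()))

count-lookup : ∀ {m} (A : Subset m) → ∣ A ∣ ≡ count (lookup A)
count-lookup []          = refl
count-lookup (true ∷ A)  = cong suc (count-lookup A)
count-lookup (false ∷ A) = count-lookup A

count-tabulate : ∀ {m} (P : Fin m → Bool) → ∣ tabulate P ∣ ≡ count P
count-tabulate P = trans (count-lookup (tabulate P)) (count-cong (lookup∘tabulate P))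

allSubsets-complete : ∀ {m} (A : Subset m) → A ∈ₗ allSubsets m
allSubsets-complete []                = here refl
allSubsets-complete {suc m} (true ∷ A)  = ∈-++⁺ˡ (∈-map⁺ (true ∷_) (allSubsets-complete A))
allSubsets-complete {suc m} (false ∷ A) =
  ∈-++⁺ʳ (map (true ∷_) (allSubsets m)) (∈-map⁺ (false ∷_) (allSubsets-complete A))

module _ (G : Graph) where

  Vertex : Set
  Vertex = Fin (n G)

  -- The open neighbourhood N(P); the closed one N[P] = P ∪ N(P) is the
  -- predicate underlying Defs' N[ G ] A.
  N : (Vertex → Bool) → Vertex → Bool
  N P x = any (λ u → P u ∧ adj G u x) (allFin (n G))

  N-intro : ∀ {P u x} → P u ≡ true → adj G u x ≡ true → N P x ≡ true
  N-intro {u = u} Pu ux = T⇒≡ (any⁺ _ (lose (∈-allFin u) (≡⇒T (cong₂ _∧_ Pu ux))))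

  N-elim : ∀ {P x} → N P x ≡ true → ∃ λ u → P u ≡ true × adj G u x ≡ true
  N-elim h with satisfied (any⁻ _ (allFin (n G)) (≡⇒T h))
  ... | u , Pu∧ux = u , ∧-elim (T⇒≡ Pu∧ux)

  N-mono : ∀ {P Q} → P ⊆ Q → N P ⊆ N Q
  N-mono P⊆Q x h with N-elim h
  ... | u , Pu , ux = N-intro (P⊆Q u Pu) ux

  N-cong : ∀ {P Q} → (∀ x → P x ≡ Q x) → ∀ x → N P x ≡ N Q x
  N-cong P≗Q x = cong or (map-cong (λ u → cong (_∧ adj G u x) (P≗Q u)) (allFin (n G)))

  IndependentSet : (Vertex → Bool) → Set
  IndependentSet P = ∀ u v → P u ≡ true → P v ≡ true → adj G u v ≡ false

  -- T is closed under adjacency, i.e. a union of connected components.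
  Closed : (Vertex → Bool) → Set
  Closed T = ∀ x y → T x ≡ true → adj G x y ≡ true → T y ≡ true

  independent-N-disjoint : ∀ {B} → IndependentSet B → Disjoint B (N B)
  independent-N-disjoint ind x Bx NBx with N-elim NBx
  ... | u , Bu , ux with () ← trans (sym ux) (ind u x Bu Bx)

  N-closed : ∀ {P T} → Closed T → P ⊆ T → N P ⊆ T
  N-closed closed P⊆T x h with N-elim h
  ... | u , Pu , ux = closed u x (P⊆T u Pu) ux

  closed-reach : ∀ {T a b} → Closed T → T a ≡ true → Star (Adj G) a b → T b ≡ true
  closed-reach closed Ta ε        = Ta
  closed-reach closed Ta (e ◅ es) = closed-reach closed (closed _ _ Ta e) es

  degree : Vertex → ℕ
  degree u = count (adj G u)

  Regular : ℕ → Set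
  Regular d = ∀ v → degree v ≡ d

  -- An automorphism carrying v to u carries the neighbours of v onto those of u.
  vertex-transitive⇒regular : VertexTransitive G → ∀ u → Regular (degree u)
  vertex-transitive⇒regular vt u v with vt v u
  ... | π , automorphism , refl = begin
    count (adj G v)                                   ≡⟨ count-cong (λ w → sym (automorphism v w)) ⟩
    sum (λ w → 𝟙 (adj G (π ⟨$⟩ʳ v) (π ⟨$⟩ʳ w)))        ≡⟨ sym (sum-permute (𝟙 ∘ adj G (π ⟨$⟩ʳ v)) π) ⟩
    count (adj G (π ⟨$⟩ʳ v))                           ∎
    where open ≡-Reasoning

  degree-zero⇒isolated : ∀ {u} → degree u ≡ 0 → ∀ v → adj G u v ≡ false
  degree-zero⇒isolated {u} deg≡0 v = 𝟙≤0 (subst (𝟙 (adj G u v) ≤_) deg≡0 (term≤sum (𝟙 ∘ adj G u) v))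

  -- The edges leaving P are
  -- counted once at their tails (|P|·d of them) and once at their heads,
  -- each head v lying in N(P) and receiving at most d of them.
  module Expansion {d : ℕ} (regular : Regular d) (P : Vertex → Bool) where

    inflow : Vertex → ℕ
    inflow v = count (λ u → P u ∧ adj G u v)

    edges-from-P : count P * d ≡ sum inflow
    edges-from-P = begin
      count P * d                             ≡⟨ *-distribʳ-sum d (𝟙 ∘ P) ⟩
      sum (λ u → 𝟙 (P u) * d)                 ≡⟨ sum-cong-≗ (λ u → cong (𝟙 (P u) *_) (sym (regular u))) ⟩
      sum (λ u → 𝟙 (P u) * degree u)          ≡⟨ sum-cong-≗ (λ u → sym (count-guarded (P u) (adj G u))) ⟩
      sum (λ u → count (λ v → P u ∧ adj G u v)) ≡⟨ ∑-comm (λ u v → 𝟙 (P u ∧ adj G u v)) ⟩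
      sum inflow                              ∎
      where open ≡-Reasoning

    inflow-edge : ∀ v u → P u ∧ adj G u v ≡ true → N P v ∧ adj G v u ≡ true
    inflow-edge v u h with ∧-elim h
    ... | Pu , uv = cong₂ _∧_ (N-intro Pu uv) (trans (adj-sym G v u) uv)

    capacity : ∀ v → count (λ u → N P v ∧ adj G v u) ≡ 𝟙 (N P v) * d
    capacity v = trans (count-guarded (N P v) (adj G v)) (cong (𝟙 (N P v) *_) (regular v))

    inflow≤ : ∀ v → inflow v ≤ 𝟙 (N P v) * d
    inflow≤ v = ≤-trans (count-mono (inflow-edge v)) (≤-reflexive (capacity v))

    inflow< : ∀ {v w} → N P v ≡ true → adj G v w ≡ true → P w ≡ false → inflow v < 𝟙 (N P v) * d
    inflow< {v} {w} NPv vw Pw =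
      <-≤-trans (count-mono-< (inflow-edge v) (cong₂ _∧_ NPv vw) (cong (_∧ adj G w v) Pw))
                (≤-reflexive (capacity v))

    edges-into-N : sum (λ v → 𝟙 (N P v) * d) ≡ count (N P) * d
    edges-into-N = sym (*-distribʳ-sum d (𝟙 ∘ N P))

    expansion : count P * d ≤ count (N P) * d
    expansion = begin
      count P * d                  ≡⟨ edges-from-P ⟩
      sum inflow                   ≤⟨ sum-mono inflow≤ ⟩
      sum (λ v → 𝟙 (N P v) * d)    ≡⟨ edges-into-N ⟩
      count (N P) * d              ∎
      where open ≤-Reasoning

    expansion-strict : ∀ {v w} → N P v ≡ true → adj G v w ≡ true → P w ≡ false →
                       count P * d < count (N P) * d
    expansion-strict {v} NPv vw Pw = begin-strict
      count P * d                  ≡⟨ edges-from-P ⟩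
      sum inflow                   <⟨ sum-mono-< inflow≤ v (inflow< NPv vw Pw) ⟩
      sum (λ v → 𝟙 (N P v) * d)    ≡⟨ edges-into-N ⟩
      count (N P) * d              ∎
      where open ≤-Reasoning

    tight⇒closed : count (N P) * d ≤ count P * d → Closed (P ∪ N P)
    tight⇒closed tight x y N[P]x xy with P x in Px
    ... | true  = ∪-⊆ʳ {P = P} {Q = N P} y (N-intro Px xy)
    ... | false with P y in Py
    ...   | true  = refl
    ...   | false = ⊥-elim (≤⇒≯ tight (expansion-strict N[P]x xy Py))

  expansion-positive : ∀ {d} → Regular (suc d) → ∀ P → count P ≤ count (N P)
  expansion-positive {d} regular P = *-cancelʳ-≤ (count P) (count (N P)) (suc d) (Expansion.expansion regular P)

  -- Components.  The ball of radius k around u grows strictly until it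
  -- becomes closed, so some ball is closed; it is the component of u.
  ball : Vertex → ℕ → Vertex → Bool
  ball u zero    x = does (x ≟ u)
  ball u (suc k)   = ball u k ∪ N (ball u k)

  ball-centre : ∀ u k → ball u k u ≡ true
  ball-centre u zero    = dec-true (u ≟ u) refl
  ball-centre u (suc k) = ∪-⊆ˡ {P = ball u k} {Q = N (ball u k)} u (ball-centre u k)

  ball-reachable : ∀ u k x → ball u k x ≡ true → Star (Adj G) u x
  ball-reachable u zero x h with x ≟ u
  ... | yes refl = ε
  ball-reachable u (suc k) x h with ball u k x in inner
  ... | true  = ball-reachable u k x inner
  ... | false with N-elim h
  ...   | w , inner-w , wx = ball-reachable u k w inner-w ◅◅ (wx ◅ ε)

  ball-grows : ∀ u k → (∃ λ j → Closed (ball u j)) ⊎ k < count (ball u k)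
  ball-grows u zero = inj₂ (subst (λ b → 𝟙 b ≤ count (ball u 0)) (ball-centre u 0) (term≤sum (𝟙 ∘ ball u 0) u))
  ball-grows u (suc k) with ball-grows u k
  ... | inj₁ closed = inj₁ closed
  ... | inj₂ k<size with ⊆-or-escape (ball u (suc k)) (ball u k)
  ...   | inj₁ stable = inj₁ (k , λ x y ux xy → stable y (∪-⊆ʳ {P = ball u k} {Q = N (ball u k)} y (N-intro ux xy)))
  ...   | inj₂ (x , new , old) =
    inj₂ (≤-<-trans k<size (count-mono-< (∪-⊆ˡ {P = ball u k} {Q = N (ball u k)}) new old))

  component : (u : Vertex) → ∃ λ T → Closed T × T u ≡ true × (∀ x → T x ≡ true → Star (Adj G) u x)
  component u with ball-grows u (n G)
  ... | inj₁ (j , closed) = ball u j , closed , ball-centre u j , ball-reachable u j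
  ... | inj₂ n<size       = ⊥-elim (<⇒≱ n<size (count≤ (ball u (n G))))

  in-component? : ∀ u v → Dec (proj₁ (component u) v ≡ true)
  in-component? u v = proj₁ (component u) v Bool.≟ true

  disconnected⇒cut : Disconnected G → ∃₂ λ u v → ∃ λ T → Closed T × T u ≡ true × T v ≡ false
  disconnected⇒cut disconnected with all? (λ u → all? (in-component? u))
  ... | yes everything-reached =
    ⊥-elim (disconnected (λ u v → proj₂ (proj₂ (proj₂ (component u))) v (everything-reached u v)))
  ... | no ¬everything with ¬∀⟶∃¬ (n G) _ (λ u → all? (in-component? u)) ¬everything
  ...   | u , ¬all-from-u with ¬∀⟶∃¬ (n G) _ (in-component? u) ¬all-from-u
  ...     | v , ¬reached with component u
  ...       | T , closed , Tu , _ = u , v , T , closed , Tu , ¬-not ¬reached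

  α-step : Subset (n G) → ℕ → ℕ
  α-step A r = if independentᵇ G A then ∣ A ∣ ⊔ r else r

  independentᵇ-sound : ∀ A → independentᵇ G A ≡ true → IndependentSet (lookup A)
  independentᵇ-sound A h u v Au Av = not-true (subst₂ (λ a b → not (a ∧ b ∧ adj G u v) ≡ true) Au Av pair-ok)
    where
    pair-ok : not (lookup A u ∧ lookup A v ∧ adj G u v) ≡ true
    pair-ok = All.lookup (map⁻ (All.lookup (map⁻ (concat⁻ (and-true⁻ _ h))) (∈-allFin u))) (∈-allFin v)

  independentᵇ-complete : ∀ A → IndependentSet (lookup A) → independentᵇ G A ≡ true
  independentᵇ-complete A ind =
    and-true⁺ (concat⁺ (map⁺ (tabulate⁺ λ u → map⁺ (tabulate⁺ λ v →
      pair-ok (lookup A u) (lookup A v) (adj G u v) (ind u v)))))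
    where
    pair-ok : ∀ a b e → (a ≡ true → b ≡ true → e ≡ false) → not (a ∧ b ∧ e) ≡ true
    pair-ok true  true  e h rewrite h refl refl = refl
    pair-ok true  false _ _ = refl
    pair-ok false _     _ _ = refl

  α-step-≥ : ∀ {A} L → A ∈ₗ L → independentᵇ G A ≡ true → ∣ A ∣ ≤ foldr α-step 0 L
  α-step-≥ (B ∷ L) (here refl) indᵇ rewrite indᵇ = m≤m⊔n _ _
  α-step-≥ (B ∷ L) (there A∈L) indᵇ with independentᵇ G B
  ... | true  = ≤-trans (α-step-≥ L A∈L indᵇ) (m≤n⊔m _ _)
  ... | false = α-step-≥ L A∈L indᵇ

  α-step-attained : ∀ L → foldr α-step 0 L ≡ 0 ⊎ ∃ λ A → independentᵇ G A ≡ true × ∣ A ∣ ≡ foldr α-step 0 L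
  α-step-attained []      = inj₁ refl
  α-step-attained (A ∷ L) with independentᵇ G A in indᵇ
  ... | false = α-step-attained L
  ... | true with ⊔-sel ∣ A ∣ (foldr α-step 0 L)
  ...   | inj₁ max≡A    = inj₂ (A , indᵇ , sym max≡A)
  ...   | inj₂ max≡rest with α-step-attained L
  ...     | inj₁ rest≡0            = inj₁ (trans max≡rest rest≡0)
  ...     | inj₂ (B , indᵇ′ , B≡rest) = inj₂ (B , indᵇ′ , trans B≡rest (sym max≡rest))

  IndependentSet-cong : ∀ {P Q} → (∀ x → P x ≡ Q x) → IndependentSet P → IndependentSet Q
  IndependentSet-cong P≗Q ind u v Qu Qv = ind u v (trans (P≗Q u) Qu) (trans (P≗Q v) Qv)

  α-lower : ∀ {P} → IndependentSet P → count P ≤ α G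
  α-lower {P} ind = subst (_≤ α G) (count-tabulate P)
    (α-step-≥ (allSubsets (n G)) (allSubsets-complete (tabulate P))
      (independentᵇ-complete (tabulate P) (IndependentSet-cong (λ x → sym (lookup∘tabulate P x)) ind)))

  α-attained : ∃ λ P → IndependentSet P × count P ≡ α G
  α-attained with α-step-attained (allSubsets (n G))
  ... | inj₁ α≡0          = (λ _ → false) , (λ _ _ ()) , trans (sum-replicate-zero (n G)) (sym α≡0)
  ... | inj₂ (A , indᵇ , A≡α) = lookup A , independentᵇ-sound A indᵇ , trans (sym (count-lookup A)) A≡α

  Imprimitiveᵖ : (Vertex → Bool) → Set
  Imprimitiveᵖ P = IndependentSet P × (∃ λ u → P u ≡ true) × count P < α G ×
                   count P * n G ≡ α G * count (P ∪ N P)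

  imprimitive-elim : IS-imprimitive G → ∃ Imprimitiveᵖ
  imprimitive-elim (A , ind , (u , u∈A) , small , balanced) =
    lookup A ,
    (λ x y Ax Ay → ind x y (lookup⇒[]= x A Ax) (lookup⇒[]= y A Ay)) ,
    (u , []=⇒lookup u∈A) ,
    subst (_< α G) (count-lookup A) small ,
    subst₂ (λ a m → a * n G ≡ α G * m) (count-lookup A) (count-tabulate (lookup A ∪ N (lookup A))) balanced

  imprimitive-intro : ∀ {P} → Imprimitiveᵖ P → IS-imprimitive G
  imprimitive-intro {P} (ind , (u , Pu) , small , balanced) =
    tabulate P ,
    (λ x y x∈A y∈A → ind x y (member x∈A) (member y∈A)) ,
    (u , lookup⇒[]= u (tabulate P) (trans (lookup∘tabulate P u) Pu)) ,
    subst (_< α G) (sym (count-tabulate P)) small ,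
    subst₂ (λ a m → a * n G ≡ α G * m) (sym (count-tabulate P)) (sym N[A]-size) balanced
    where
    member : ∀ {x} → x ∈ tabulate P → P x ≡ true
    member {x} x∈A = trans (sym (lookup∘tabulate P x)) ([]=⇒lookup x∈A)

    N[A]-size : ∣ N[ G ] (tabulate P) ∣ ≡ count (P ∪ N P)
    N[A]-size = trans (count-tabulate (lookup (tabulate P) ∪ N (lookup (tabulate P))))
      (count-cong (λ x → cong₂ _∨_ (lookup∘tabulate P x) (N-cong (lookup∘tabulate P) x)))

  ProperColouring : (Vertex → Bool) → Set
  ProperColouring c = ∀ u v → adj G u v ≡ true → c u ≢ c v

  -- Swapping the two colours if necessary, any given vertex can be coloured true.
  colouring-at : Bipartite G → ∀ u → ∃ λ c → ProperColouring c × c u ≡ true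
  colouring-at (c , proper) u with c u in cu
  ... | true  = c , proper , cu
  ... | false = ∁ c , (λ x y xy same → proper x y xy (not-injective same)) , cong not cu

  module Colouring {c : Vertex → Bool} (proper : ProperColouring c) where

    neighbour-colour : ∀ {u v} → adj G u v ≡ true → c v ≡ not (c u)
    neighbour-colour {u} {v} uv = ¬-not (λ same → proper u v uv (sym same))

    N-flips : ∀ {P} → N (P ∩ c) ⊆ ∁ c
    N-flips {P} x h with N-elim h
    ... | u , Pcu , ux = trans (cong not (neighbour-colour ux)) (cong (not ∘ not) (∩-⊆ʳ {P = P} {Q = c} u Pcu))

    N-flips′ : ∀ {P} → N (P ∩ ∁ c) ⊆ c
    N-flips′ {P} x h with N-elim h
    ... | u , Pc̄u , ux = trans (neighbour-colour ux) (∩-⊆ʳ {P = P} {Q = ∁ c} u Pc̄u)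

    monochromatic⇒independent : ∀ {P} → (∀ x y → P x ≡ true → P y ≡ true → c x ≡ c y) → IndependentSet P
    monochromatic⇒independent same-colour x y Px Py with adj G x y in xy
    ... | false = refl
    ... | true  = ⊥-elim (proper x y xy (same-colour x y Px Py))

    ∩-colour-independent : ∀ {P} → IndependentSet (P ∩ c)
    ∩-colour-independent {P} = monochromatic⇒independent λ x y Px Py →
      trans (∩-⊆ʳ {P = P} {Q = c} x Px) (sym (∩-⊆ʳ {P = P} {Q = c} y Py))

    ∩-∁colour-independent : ∀ {P} → IndependentSet (P ∩ ∁ c)
    ∩-∁colour-independent {P} = monochromatic⇒independent λ x y Px Py →
      trans (not-true (∩-⊆ʳ {P = P} {Q = ∁ c} x Px)) (sym (not-true (∩-⊆ʳ {P = P} {Q = ∁ c} y Py)))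

    -- The two colour classes are independent and cover V, so |V| ≤ 2α.
    order≤2α : n G ≤ α G + α G
    order≤2α = begin
      n G                         ≡⟨ sym count-all ⟩
      count everything            ≡⟨ count-split everything c ⟩
      count (everything ∩ c) + count (everything ∩ ∁ c)
                                  ≤⟨ +-mono-≤ (α-lower ∩-colour-independent) (α-lower ∩-∁colour-independent) ⟩
      α G + α G                   ∎
      where
      open ≤-Reasoning
      everything : Vertex → Bool
      everything _ = true

    module Halves {B : Vertex → Bool} (independent : IndependentSet B) where

      B₁ B₂ : Vertex → Bool
      B₁ = B ∩ c
      B₂ = B ∩ ∁ c

      -- B₁ and N(B₂) are disjoint and of colour c inside N[B]; symmetrically
      -- for B₂ and N(B₁).  Hence |B| + |N(B₁)| + |N(B₂)| ≤ |N[B]|.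
      halves-disjoint : count B + (count (N B₁) + count (N B₂)) ≤ count (B ∪ N B)
      halves-disjoint = begin
        count B + (count (N B₁) + count (N B₂))
          ≡⟨ cong (_+ (count (N B₁) + count (N B₂))) (count-split B c) ⟩
        count B₁ + count B₂ + (count (N B₁) + count (N B₂))
          ≡⟨ regroup (count B₁) (count B₂) (count (N B₁)) (count (N B₂)) ⟩
        (count B₁ + count (N B₂)) + (count B₂ + count (N B₁))
          ≤⟨ +-mono-≤ colour-side other-side ⟩
        count ((B ∪ N B) ∩ c) + count ((B ∪ N B) ∩ ∁ c)
          ≡⟨ sym (count-split (B ∪ N B) c) ⟩
        count (B ∪ N B) ∎
        where
        open ≤-Reasoning
        regroup : ∀ a₁ a₂ m₁ m₂ → a₁ + a₂ + (m₁ + m₂) ≡ (a₁ + m₂) + (a₂ + m₁)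
        regroup = solve-∀
        B⊆N[B] : B ⊆ B ∪ N B
        B⊆N[B] = ∪-⊆ˡ {P = B} {Q = N B}
        NBᵢ⊆N[B] : ∀ {K} → N (B ∩ K) ⊆ B ∪ N B
        NBᵢ⊆N[B] {K} = ⊆-trans (N-mono (∩-⊆ˡ {P = B} {Q = K})) (∪-⊆ʳ {P = B} {Q = N B})
        colour-side : count B₁ + count (N B₂) ≤ count ((B ∪ N B) ∩ c)
        colour-side = count-disjoint-≤
          (Disjoint-mono (∩-⊆ˡ {P = B} {Q = c}) (N-mono (∩-⊆ˡ {P = B} {Q = ∁ c})) (independent-N-disjoint independent))
          (⊆-∩ (⊆-trans (∩-⊆ˡ {P = B} {Q = c}) B⊆N[B]) (∩-⊆ʳ {P = B} {Q = c}))
          (⊆-∩ NBᵢ⊆N[B] (N-flips′ {B}))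
        other-side : count B₂ + count (N B₁) ≤ count ((B ∪ N B) ∩ ∁ c)
        other-side = count-disjoint-≤
          (Disjoint-mono (∩-⊆ˡ {P = B} {Q = ∁ c}) (N-mono (∩-⊆ˡ {P = B} {Q = c})) (independent-N-disjoint independent))
          (⊆-∩ (⊆-trans (∩-⊆ˡ {P = B} {Q = ∁ c}) B⊆N[B]) (∩-⊆ʳ {P = B} {Q = ∁ c}))
          (⊆-∩ NBᵢ⊆N[B] (N-flips {B}))

      -- If N[B] has at most 2|B| vertices, then |N(B₁)| + |N(B₂)| ≤ |B₁| + |B₂|,
      -- so the expansion of B₁ is tight (the degree d may be 0) and
      -- B₁ ∪ N(B₁) is closed.
      tight-half-closed : ∀ {d} → Regular d → count (B ∪ N B) ≤ count B + count B → Closed (B₁ ∪ N B₁)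
      tight-half-closed {d} regular small = Expansion.tight⇒closed regular B₁
        (cancel-pair (Expansion.expansion regular B₂) scaled)
        where
        open ≤-Reasoning
        neighbours≤halves : count (N B₁) + count (N B₂) ≤ count B₁ + count B₂
        neighbours≤halves = +-cancelˡ-≤ (count B) _ _ (begin
          count B + (count (N B₁) + count (N B₂))  ≤⟨ halves-disjoint ⟩
          count (B ∪ N B)                          ≤⟨ small ⟩
          count B + count B                        ≡⟨ cong (count B +_) (count-split B c) ⟩
          count B + (count B₁ + count B₂)          ∎)
        scaled : count (N B₁) * d + count (N B₂) * d ≤ count B₁ * d + count B₂ * d
        scaled = subst₂ _≤_ (*-distribʳ-+ d (count (N B₁)) (count (N B₂))) (*-distribʳ-+ d (count B₁) (count B₂))
                        (*-monoˡ-≤ d neighbours≤halves)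

      -- For positive degree both halves expand, so |N[B]| ≥ 2|B|.
      double-expansion : ∀ {d} → Regular (suc d) → count B + count B ≤ count (B ∪ N B)
      double-expansion regular = begin
        count B + count B                        ≡⟨ cong (count B +_) (count-split B c) ⟩
        count B + (count B₁ + count B₂)          ≤⟨ +-monoʳ-≤ (count B) (+-mono-≤ (expansion-positive regular B₁)
                                                                                  (expansion-positive regular B₂)) ⟩
        count B + (count (N B₁) + count (N B₂))  ≤⟨ halves-disjoint ⟩
        count (B ∪ N B)                          ∎
        where open ≤-Reasoning

    order≡2α : ∀ {d} → Regular (suc d) → α G + α G ≡ n G
    order≡2α regular with α-attained
    ... | P , independent , P≡α = ≤-antisym (begin
      α G + α G          ≡⟨ cong₂ _+_ (sym P≡α) (sym P≡α) ⟩
      count P + count P  ≤⟨ Halves.double-expansion independent regular ⟩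
      count (P ∪ N P)    ≤⟨ count≤ (P ∪ N P) ⟩
      n G                ∎) order≤2α
      where open ≤-Reasoning

  -- (⇒) A connected vertex-transitive bipartite graph has no imprimitive set:
  -- N[P] ≤ 2|P| makes B₁ ∪ N(B₁) closed, so it is everything, and |P| = α.
  connected⇒primitive : VertexTransitive G → Bipartite G → Connected G → ∀ {P} → Imprimitiveᵖ P → ⊥
  connected⇒primitive vt bipartite connected {P} (independent , (s , Ps) , small , balanced)
    with colouring-at bipartite s
  ... | c , proper , cs = <-irrefl P≡α small
    where
    open Colouring proper
    open Halves independent

    N[P]-small : count (P ∪ N P) ≤ count P + count P
    N[P]-small = ratio-bound balanced order≤2α small

    B₁-component : Closed (B₁ ∪ N B₁)
    B₁-component = tight-half-closed (vertex-transitive⇒regular vt s) N[P]-small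

    N[P]-everything : ∀ x → (P ∪ N P) x ≡ true
    N[P]-everything x =
      ∪-mono (∩-⊆ˡ {P = P} {Q = c}) (N-mono (∩-⊆ˡ {P = P} {Q = c})) x
        (closed-reach B₁-component (∪-⊆ˡ {P = B₁} {Q = N B₁} s (cong₂ _∧_ Ps cs)) (connected s x))

    P≡α : count P ≡ α G
    P≡α = *-cancelʳ-≡ (count P) (α G) (n G) {{nonZeroIndex s}}
            (trans balanced (cong (α G *_) (count-full N[P]-everything)))

  -- In an edgeless graph α = |V| and N[P] = P, so any P with |P| < |V| has
  -- the imprimitive size and ratio.
  edgeless-balanced : (∀ x y → adj G x y ≡ false) → ∀ {P} → count P < n G →
                      count P < α G × count P * n G ≡ α G * count (P ∪ N P)
  edgeless-balanced edgeless {P} P<n = subst (count P <_) (sym α≡n) P<n , (begin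
    count P * n G          ≡⟨ *-comm (count P) (n G) ⟩
    n G * count P          ≡⟨ cong₂ _*_ (sym α≡n) (sym N[P]≡P) ⟩
    α G * count (P ∪ N P)  ∎)
    where
    open ≡-Reasoning
    α≡n : α G ≡ n G
    α≡n with α-attained
    ... | Q , _ , Q≡α = ≤-antisym (subst (_≤ n G) Q≡α (count≤ Q))
                                  (subst (_≤ α G) count-all (α-lower (λ x y _ _ → edgeless x y)))
    no-neighbours : ∀ x → N P x ≡ false
    no-neighbours x with N P x in NPx
    ... | false = refl
    ... | true with N-elim NPx
    ...   | u , _ , ux with () ← trans (sym ux) (edgeless u x)
    N[P]≡P : count (P ∪ N P) ≡ count P
    N[P]≡P = count-cong (λ x → trans (cong (P x ∨_) (no-neighbours x)) (∨-identityʳ (P x)))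

  module Cut {c : Vertex → Bool} (proper : ProperColouring c) {T : Vertex → Bool} (closed : Closed T) where
    open Colouring proper

    A Ā : Vertex → Bool
    A = T ∩ c
    Ā = T ∩ ∁ c

    N-A⊆Ā : N A ⊆ Ā
    N-A⊆Ā = ⊆-∩ (N-closed closed (∩-⊆ˡ {P = T} {Q = c})) (N-flips {T})

    N-Ā⊆A : N Ā ⊆ A
    N-Ā⊆A = ⊆-∩ (N-closed closed (∩-⊆ˡ {P = T} {Q = ∁ c})) (N-flips′ {T})

    -- For positive degree |A| ≤ |N(A)| ≤ |Ā| ≤ |N(Ā)| ≤ |A|, so |N[A]| = 2|A|;
    -- if T misses a vertex, 2|A| ≤ |T| < |V| = 2α.
    regular-balanced : ∀ {d v} → Regular (suc d) → T v ≡ false →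
                       count A < α G × count A * n G ≡ α G * count (A ∪ N A)
    regular-balanced regular Tv = small , balanced
      where
      N-A≡A : count (N A) ≡ count A
      N-A≡A = ≤-antisym (begin
        count (N A)  ≤⟨ count-mono N-A⊆Ā ⟩
        count Ā      ≤⟨ expansion-positive regular Ā ⟩
        count (N Ā)  ≤⟨ count-mono N-Ā⊆A ⟩
        count A      ∎) (expansion-positive regular A)
        where open ≤-Reasoning

      N[A]≡2A : count (A ∪ N A) ≡ count A + count A
      N[A]≡2A = trans (count-disjoint-∪ (Disjoint-mono (λ _ → id) N-A⊆Ā (∩-∁-disjoint {P = T} {Q = T} {c = c})))
                      (cong (count A +_) N-A≡A)

      small : count A < α G
      small = half-< (begin-strict
        count A + count A      ≡⟨ cong (count A +_) (sym N-A≡A) ⟩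
        count A + count (N A)  ≤⟨ +-monoʳ-≤ (count A) (count-mono N-A⊆Ā) ⟩
        count A + count Ā      ≡⟨ sym (count-split T c) ⟩
        count T                <⟨ count-< Tv ⟩
        n G                    ≡⟨ sym (order≡2α regular) ⟩
        α G + α G              ∎)
        where open ≤-Reasoning

      balanced : count A * n G ≡ α G * count (A ∪ N A)
      balanced = begin
        count A * n G              ≡⟨ cong (count A *_) (sym (order≡2α regular)) ⟩
        count A * (α G + α G)      ≡⟨ double-swap (count A) (α G) ⟩
        α G * (count A + count A)  ≡⟨ cong (α G *_) (sym N[A]≡2A) ⟩
        α G * count (A ∪ N A)      ∎
        where open ≡-Reasoning

  -- (⇐) Cut a disconnected graph along a component T of u and colour u true;
  -- then T ∩ c is imprimitive.
  disconnected⇒imprimitive : VertexTransitive G → Bipartite G → Disconnected G → IS-imprimitive G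
  disconnected⇒imprimitive vt bipartite disconnected with disconnected⇒cut disconnected
  ... | u , v , T , closed , Tu , Tv with colouring-at bipartite u
  ... | c , proper , cu =
    imprimitive-intro (∩-colour-independent {T} , (u , cong₂ _∧_ Tu cu) , balanced (degree u) refl)
    where
    open Colouring proper
    open Cut proper closed

    balanced : ∀ d → degree u ≡ d → count A < α G × count A * n G ≡ α G * count (A ∪ N A)
    balanced zero    deg≡0 = edgeless-balanced
      (λ x → degree-zero⇒isolated (trans (vertex-transitive⇒regular vt u x) deg≡0))
      (≤-<-trans (count-mono (∩-⊆ˡ {P = T} {Q = c})) (count-< Tv))
    balanced (suc d) deg≡  = regular-balanced (λ x → trans (vertex-transitive⇒regular vt u x) deg≡) Tv

lemma3p2 : (G : Graph) → VertexTransitive G → Bipartite G →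
    (IS-imprimitive G → Disconnected G) × (Disconnected G → IS-imprimitive G)
lemma3p2 G vt bipartite =
  (λ imprimitive connected → connected⇒primitive G vt bipartite connected (proj₂ (imprimitive-elim G imprimitive))) ,
  disconnected⇒imprimitive G vt bipartite
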